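{- Let $(\alpha_k)_{k\ge1},(\beta_k)_{k\ge1},(\gamma_k)_{k\ge1}$ be weight sequences with $\alpha(x)=\sum_{k\ge1}\alpha_kx^k$, $\beta(x)=\sum_{k\ge1}\beta_kx^k$, $\gamma(x)=\sum_{k\ge1}\gamma_kx^k$, and suppose $\gamma(x)=\alpha(x)\beta(x)$. Let $V_n$ be the total weight of the set $\mathcal{V}_n$ of weighted Dyck paths of length $2n$ described in the context. Then $$\sum_{n\ge0}V_nx^n=\frac{1-\alpha(x)}{1-\alpha(x)-\alpha(x)\beta(x)}.$$
   Context: A Dyck path of length $2n$ is a lattice path from $(0,0)$ to $(2n,0)$ with steps $\mathbf{u}=(1,1)$ and $\mathbf{d}=(1,-1)$ that never goes below the $x$-axis. A valley is an occurrence of $\mathbf{du}$; its level is the ordinate of the common point of its two steps. A pyramid is a consecutive section $\mathbf{u}^h\mathbf{d}^h$ ($h\ge1$ is its height); it is maximal if it cannot be extended to a section $\mathbf{u}^{h+1}\mathbf{d}^{h+1}$; its altitude is the ordinate of the endpoint of its last $\mathbf{d}$-step. A Dyck path is primitive if it is nonempty and touches the $x$-axis only at its two endpoints. Let $\mathcal{A}_n$ be the set of primitive Dyck paths $P$ of length $2n$ all of whose valleys (if any) lie at the same level, each carrying a weight $w(P)$ defined as follows: if $P$ has no valley, then $P=\mathbf{u}^n\mathbf{d}^n$ is a maximal pyramid of height $n$ at altitude $0$ and $w(P)=\gamma_n$; otherwise all valleys are at a common level $k\ge1$ and $P=\mathbf{u}^k\,\mathbf{u}^{i_1}\mathbf{d}^{i_1}\cdots\mathbf{u}^{i_r}\mathbf{d}^{i_r}\,\mathbf{d}^k$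 with $r\ge2$, $i_1,\dots,i_r\ge1$, and $w(P)=\beta_k\alpha_{i_1}\cdots\alpha_{i_r}$ (each maximal pyramid of height $i$ at altitude $\ge1$ contributes $\alpha_i$, and the initial segment $\mathbf{u}^k$ contributes $\beta_k$). Only paths of nonzero weight are kept in $\mathcal{A}_n$. Let $\mathcal{V}_n$ be the set of Dyck paths of length $2n$ that are concatenations $P_1\cdots P_m$ ($m\ge0$; $m=0$ gives the empty path) of paths $P_j\in\bigcup_{s\ge1}\mathcal{A}_s$, with weight $\prod_j w(P_j)$ (the empty path has weight $1$), and $V_n=\sum_{P\in\mathcal{V}_n}w(P)$. -}

module Defs where

open import Level using (Level)
open import Data.Nat using (ℕ; zero; suc; _∸_; _≡ᵇ_)
open import Data.Bool using (Bool; true; false; if_then_else_; _∧_)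
open import Data.List using (List; []; _∷_; _++_; map; foldr; reverse; length; take; drop; filter; concatMap)
open import Algebra.Bundles using (CommutativeRing)

data Step : Set where
  U D : Step

words : ℕ → List (List Step)
words zero    = [] ∷ []
words (suc m) = concatMap (λ w → (U ∷ w) ∷ (D ∷ w) ∷ []) (words m)

dyckFrom : ℕ → List Step → Bool
dyckFrom zero    []       = true
dyckFrom (suc _) []       = false
dyckFrom h       (U ∷ xs) = dyckFrom (suc h) xs
dyckFrom zero    (D ∷ xs) = false
dyckFrom (suc h) (D ∷ xs) = dyckFrom h xs

isDyck : List Step → Bool
isDyck = dyckFrom 0

dyckPaths : ℕ → List (List Step)
dyckPaths n = filter (λ w → isDyck w Data.Bool.≟ true) (words (n Data.Nat.+ n))

-- decomposition of a Dyck path into its primitive factors (returns to the axis);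
-- arguments: current height, reversed current factor, remaining word
primsAux : ℕ → List Step → List Step → List (List Step)
primsAux _ []  [] = []
primsAux _ acc [] = reverse acc ∷ []
primsAux h acc (U ∷ xs) = primsAux (suc h) (U ∷ acc) xs
primsAux zero acc (D ∷ xs) = []
primsAux (suc zero) acc (D ∷ xs) = reverse (D ∷ acc) ∷ primsAux zero [] xs
primsAux (suc (suc h)) acc (D ∷ xs) = primsAux (suc h) (D ∷ acc) xs

prims : List Step → List (List Step)
prims = primsAux 0 []

valleyLevels : ℕ → List Step → List ℕ
valleyLevels h []                = []
valleyLevels h (U ∷ xs)          = valleyLevels (suc h) xs
valleyLevels h (D ∷ [])          = []
valleyLevels h (D ∷ (U ∷ xs))    = (h ∸ 1) ∷ valleyLevels (h ∸ 1) (U ∷ xs)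
valleyLevels h (D ∷ (D ∷ xs))    = valleyLevels (h ∸ 1) (D ∷ xs)

countU : List Step → ℕ
countU []       = 0
countU (U ∷ xs) = suc (countU xs)
countU (D ∷ xs) = countU xs

allEq : ℕ → List ℕ → Bool
allEq k []       = true
allEq k (x ∷ xs) = (x ≡ᵇ k) ∧ allEq k xs

-- Weights, over an arbitrary commutative ring.  Weight sequences are
-- functions ℕ → Carrier; only the values at indices k ≥ 1 are used.

module Weights {c ℓ : Level} (R : CommutativeRing c ℓ) where
  open CommutativeRing R

  sumR : List Carrier → Carrier
  sumR = foldr _+_ 0#

  prodR : List Carrier → Carrier
  prodR = foldr _*_ 1#

  module Paths (α β γ : ℕ → Carrier) where

    -- weight of a primitive Dyck path P (0 if P ∉ 𝒜):
    --  * no valley: P = u^n d^n, weight γ_n;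
    --  * all valleys at a common level k ≥ 1: P = u^k (u^{i₁}d^{i₁}⋯u^{iᵣ}d^{iᵣ}) d^k,
    --    weight β_k α_{i₁}⋯α_{iᵣ}, the pyramids being the primitive factors of the middle part;
    --  * otherwise (valleys at different levels) P ∉ 𝒜, weight 0.
    primWeight : List Step → Carrier
    primWeight P with valleyLevels 0 P
    ... | []          = γ (countU P)
    ... | zero ∷ _    = 0#
    ... | (suc k₀) ∷ vs =
          if allEq (suc k₀) vs
          then β (suc k₀) * prodR (map (λ pyr → α (countU pyr))
                   (prims (drop (suc k₀) (take (length P ∸ suc k₀) P))))
          else 0#

    -- weight of a Dyck path as a concatenation of primitive factors
    -- (0 exactly when it is not in 𝒱_n, up to products of nonzero weights)
    pathWeight : List Step → Carrier
    pathWeight P = prodR (map primWeight (prims P))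

    V : ℕ → Carrier
    V n = sumR (map pathWeight (dyckPaths n))

  -- formal power series as coefficient sequences
  -- coefficients of Σ_{k≥1} a_k x^k
  ser : (ℕ → Carrier) → ℕ → Carrier
  ser a zero    = 0#
  ser a (suc k) = a (suc k)

  oneS : ℕ → Carrier
  oneS zero    = 1#
  oneS (suc _) = 0#

  convAux : (ℕ → Carrier) → (ℕ → Carrier) → ℕ → ℕ → Carrier
  convAux f g n zero    = f 0 * g n
  convAux f g n (suc i) = f (suc i) * g (n ∸ suc i) + convAux f g n i

  conv : (ℕ → Carrier) → (ℕ → Carrier) → ℕ → Carrier
  conv f g n = convAux f g n n

-- Cutting a Dyck path at its returns to the axis gives V = 1/(1 − A), where A is the generating function
-- of the weighted primitive paths. A primitive path u Q d of 𝒜 is either a pyramid (weight γ) or has all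
-- its valleys at one level k ≥ 1, i.e. it is u^k S d^k with S a sequence of at least two pyramids; hence
-- A = γ + βY with Y = M − 1 − α, where M = 1/(1 − α) counts the sequences of pyramids on the axis (again
-- by cutting at the returns). With γ = αβ this gives A = αβ/(1 − α) and V = (1 − α)/(1 − α − αβ).

module Submission where

open import Defs
open import Level using (Level)
open import Algebra.Bundles using (CommutativeRing)
open import Relation.Binary.Bundles using (Setoid)
open import Data.Nat using (ℕ; zero; suc; _∸_; _⊓_; _≤_; _<_; z≤n; s≤s; _≤?_; _≡ᵇ_) renaming (_+_ to _+ᴺ_)
import Data.Nat.Properties as ℕ
open import Data.Nat.Tactic.RingSolver using (solve-∀)
open import Data.Bool using (Bool; true; false; if_then_else_; _∧_)
open import Data.List using (List; []; _∷_; _++_; map; concatMap; length; take; drop; reverse; filter)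
import Data.List.Properties as List
open import Data.Product using (Σ; _×_; _,_)
open import Data.Empty using (⊥; ⊥-elim)
open import Relation.Nullary using (yes; no)
open import Relation.Binary.PropositionalEquality as ≡ using (_≡_; _≢_)

take-++ˡ : ∀ {A : Set} j (xs : List A) {ys} → j ≤ length xs → take j (xs ++ ys) ≡ take j xs
take-++ˡ zero    xs       _         = ≡.refl
take-++ˡ (suc j) (x ∷ xs) (s≤s j≤) = ≡.cong (x ∷_) (take-++ˡ j xs j≤)

take-length-++ : ∀ {A : Set} (xs : List A) {ys} → take (length xs) (xs ++ ys) ≡ xs
take-length-++ []       = ≡.refl
take-length-++ (x ∷ xs) = ≡.cong (x ∷_) (take-length-++ xs)

drop-length-++ : ∀ {A : Set} (xs : List A) {ys} → drop (length xs) (xs ++ ys) ≡ ys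
drop-length-++ []       = ≡.refl
drop-length-++ (x ∷ xs) = drop-length-++ xs

length-∷ʳ : ∀ {A : Set} (xs : List A) {x} → length (xs ++ x ∷ []) ≡ suc (length xs)
length-∷ʳ xs = ≡.trans (List.length-++ xs) (ℕ.+-comm (length xs) 1)

double-cancel-≤ : ∀ a b → a +ᴺ a ≤ b +ᴺ b → a ≤ b
double-cancel-≤ zero    b       le = z≤n
double-cancel-≤ (suc a) zero    ()
double-cancel-≤ (suc a) (suc b) (s≤s le) rewrite ℕ.+-suc a a | ℕ.+-suc b b = s≤s (double-cancel-≤ a b (ℕ.≤-pred le))

double-injective : ∀ a b → a +ᴺ a ≡ b +ᴺ b → a ≡ b
double-injective a b eq =
  ℕ.≤-antisym (double-cancel-≤ a b (ℕ.≤-reflexive eq)) (double-cancel-≤ b a (ℕ.≤-reflexive (≡.sym eq)))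

double-split : ∀ m n → m ≤ n → suc n +ᴺ suc n ≡ (suc m +ᴺ suc m) +ᴺ ((n ∸ m) +ᴺ (n ∸ m))
double-split m n le = ≡.trans (≡.cong (λ k → suc k +ᴺ suc k) (≡.sym (ℕ.m+[n∸m]≡n le))) (regroup m (n ∸ m))
  where
  regroup : ∀ m d → suc (m +ᴺ d) +ᴺ suc (m +ᴺ d) ≡ (suc m +ᴺ suc m) +ᴺ (d +ᴺ d)
  regroup = solve-∀

Word : Set
Word = List Step

elevate : Word → Word
elevate Q = U ∷ Q ++ D ∷ []

module DyckWords where
  open ≡ using (refl; sym; trans; cong; subst)

  -- from height h, w first reaches the axis at its last step
  returnsAtEnd : ℕ → Word → Bool
  returnsAtEnd zero          _            = false
  returnsAtEnd (suc h)       []           = false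
  returnsAtEnd (suc h)       (U ∷ xs)     = returnsAtEnd (suc (suc h)) xs
  returnsAtEnd (suc zero)    (D ∷ [])     = true
  returnsAtEnd (suc zero)    (D ∷ _ ∷ _)  = false
  returnsAtEnd (suc (suc h)) (D ∷ xs)     = returnsAtEnd (suc h) xs

  isPrimitive : Word → Bool
  isPrimitive (U ∷ xs) = returnsAtEnd 1 xs
  isPrimitive _        = false

  returnsAtEnd⇒dyckFrom : ∀ h xs → returnsAtEnd h xs ≡ true → dyckFrom h xs ≡ true
  returnsAtEnd⇒dyckFrom (suc h)       (U ∷ xs) e = returnsAtEnd⇒dyckFrom (suc (suc h)) xs e
  returnsAtEnd⇒dyckFrom (suc zero)    (D ∷ []) e = refl
  returnsAtEnd⇒dyckFrom (suc (suc h)) (D ∷ xs) e = returnsAtEnd⇒dyckFrom (suc h) xs e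

  primitive⇒dyck : ∀ P → isPrimitive P ≡ true → isDyck P ≡ true
  primitive⇒dyck (U ∷ xs) = returnsAtEnd⇒dyckFrom 1 xs

  dyckFrom-++ : ∀ h xs ys → dyckFrom h xs ≡ true → isDyck ys ≡ true → dyckFrom h (xs ++ ys) ≡ true
  dyckFrom-++ zero    []       ys e d = d
  dyckFrom-++ zero    (U ∷ xs) ys e d = dyckFrom-++ 1 xs ys e d
  dyckFrom-++ (suc h) (U ∷ xs) ys e d = dyckFrom-++ (suc (suc h)) xs ys e d
  dyckFrom-++ (suc h) (D ∷ xs) ys e d = dyckFrom-++ h xs ys e d

  primitive-++-dyck : ∀ j w → isPrimitive (take j w) ≡ true → isDyck (drop j w) ≡ true → isDyck w ≡ true
  primitive-++-dyck j w p r =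
    trans (cong isDyck (sym (List.take++drop≡id j w))) (dyckFrom-++ 0 (take j w) (drop j w) (primitive⇒dyck (take j w) p) r)

  length≡suc⇒≢[] : ∀ {w : Word} {L} → length w ≡ suc L → w ≢ []
  length≡suc⇒≢[] {[]}    ()
  length≡suc⇒≢[] {_ ∷ _} _ ()

  returnsAtEnd-∷ʳD : ∀ h xs → returnsAtEnd (suc h) (xs ++ D ∷ []) ≡ dyckFrom h xs
  returnsAtEnd-∷ʳD zero    []           = refl
  returnsAtEnd-∷ʳD (suc h) []           = refl
  returnsAtEnd-∷ʳD zero    (U ∷ xs)     = returnsAtEnd-∷ʳD 1 xs
  returnsAtEnd-∷ʳD (suc h) (U ∷ xs)     = returnsAtEnd-∷ʳD (suc (suc h)) xs
  returnsAtEnd-∷ʳD zero    (D ∷ [])     = refl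
  returnsAtEnd-∷ʳD zero    (D ∷ _ ∷ _)  = refl
  returnsAtEnd-∷ʳD (suc h) (D ∷ xs)     = returnsAtEnd-∷ʳD h xs

  returnsAtEnd-∷ʳU : ∀ h xs → returnsAtEnd h (xs ++ U ∷ []) ≡ false
  returnsAtEnd-∷ʳU zero          xs           = refl
  returnsAtEnd-∷ʳU (suc h)       []           = refl
  returnsAtEnd-∷ʳU (suc h)       (U ∷ xs)     = returnsAtEnd-∷ʳU (suc (suc h)) xs
  returnsAtEnd-∷ʳU (suc zero)    (D ∷ [])     = refl
  returnsAtEnd-∷ʳU (suc zero)    (D ∷ _ ∷ _)  = refl
  returnsAtEnd-∷ʳU (suc (suc h)) (D ∷ xs)     = returnsAtEnd-∷ʳU (suc h) xs

  returnsAtEnd⇒∷ʳD : ∀ h ys → returnsAtEnd (suc h) ys ≡ true →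
                     Σ Word λ Q → ys ≡ Q ++ D ∷ [] × dyckFrom h Q ≡ true
  returnsAtEnd⇒∷ʳD zero (D ∷ []) e = [] , refl , refl
  returnsAtEnd⇒∷ʳD zero (U ∷ ys) e with returnsAtEnd⇒∷ʳD 1 ys e
  ... | Q , refl , d = U ∷ Q , refl , d
  returnsAtEnd⇒∷ʳD (suc h) (U ∷ ys) e with returnsAtEnd⇒∷ʳD (suc (suc h)) ys e
  ... | Q , refl , d = U ∷ Q , refl , d
  returnsAtEnd⇒∷ʳD (suc h) (D ∷ ys) e with returnsAtEnd⇒∷ʳD h ys e
  ... | Q , refl , d = D ∷ Q , refl , d

  firstReturnFrom : ∀ h xs → dyckFrom (suc h) xs ≡ true →
    Σ Word λ ys → Σ Word λ zs → xs ≡ ys ++ zs × returnsAtEnd (suc h) ys ≡ true × isDyck zs ≡ true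
  firstReturnFrom h (U ∷ xs) e with firstReturnFrom (suc h) xs e
  ... | ys , zs , refl , r , d = U ∷ ys , zs , refl , r , d
  firstReturnFrom zero (D ∷ xs) e = D ∷ [] , xs , refl , refl , e
  firstReturnFrom (suc h) (D ∷ xs) e with firstReturnFrom h xs e
  ... | ys , zs , refl , r , d = D ∷ ys , zs , refl , r , d

  firstReturn : ∀ w → isDyck w ≡ true → w ≢ [] →
    Σ Word λ P → Σ Word λ R → w ≡ P ++ R × isPrimitive P ≡ true × isDyck R ≡ true
  firstReturn [] _ w≢[] = ⊥-elim (w≢[] refl)
  firstReturn (U ∷ w) d _ with firstReturnFrom 0 w d
  ... | ys , zs , refl , r , dz = U ∷ ys , zs , refl , r , dz

  returnsAtEnd-prefix-unique : ∀ h a b r s → returnsAtEnd h a ≡ true → returnsAtEnd h b ≡ true →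
                               a ++ r ≡ b ++ s → a ≡ b
  returnsAtEnd-prefix-unique (suc h) (U ∷ a) (U ∷ b) r s ra rb eq =
    cong (U ∷_) (returnsAtEnd-prefix-unique (suc (suc h)) a b r s ra rb (List.∷-injectiveʳ eq))
  returnsAtEnd-prefix-unique (suc zero) (D ∷ []) (D ∷ []) r s ra rb eq = refl
  returnsAtEnd-prefix-unique (suc (suc h)) (D ∷ a) (D ∷ b) r s ra rb eq =
    cong (D ∷_) (returnsAtEnd-prefix-unique (suc h) a b r s ra rb (List.∷-injectiveʳ eq))
  returnsAtEnd-prefix-unique (suc h) (U ∷ a) (D ∷ b) r s ra rb ()
  returnsAtEnd-prefix-unique (suc h) (D ∷ a) (U ∷ b) r s ra rb ()

  primitive-prefix-unique : ∀ a b r s → isPrimitive a ≡ true → isPrimitive b ≡ true →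
                            a ++ r ≡ b ++ s → a ≡ b
  primitive-prefix-unique (U ∷ a) (U ∷ b) r s pa pb eq =
    cong (U ∷_) (returnsAtEnd-prefix-unique 1 a b r s pa pb (List.∷-injectiveʳ eq))

  primitive-prefix-length : ∀ j P R → j ≤ length (P ++ R) → isPrimitive (take j (P ++ R)) ≡ true →
                            isPrimitive P ≡ true → j ≡ length P
  primitive-prefix-length j P R j≤ p′ p = begin
    j                              ≡⟨ ℕ.m≤n⇒m⊓n≡m j≤ ⟨
    j ⊓ length (P ++ R)            ≡⟨ List.length-take j (P ++ R) ⟨
    length (take j (P ++ R))       ≡⟨ cong length prefix≡P ⟩
    length P                       ∎
    where
    open ≡.≡-Reasoning
    prefix≡P : take j (P ++ R) ≡ P
    prefix≡P = primitive-prefix-unique (take j (P ++ R)) P (drop j (P ++ R)) R p′ p (List.take++drop≡id j (P ++ R))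

  dyck-induction : ∀ {p} (Pr : Word → Set p) → Pr [] →
    (∀ P R → isPrimitive P ≡ true → isDyck R ≡ true → Pr R → Pr (P ++ R)) →
    ∀ w → isDyck w ≡ true → Pr w
  dyck-induction Pr base step w = go (length w) w ℕ.≤-refl
    where
    go : ∀ N w → length w ≤ N → isDyck w ≡ true → Pr w
    go N       []       _        _ = base
    go (suc N) (U ∷ xs) (s≤s le) d with firstReturn (U ∷ xs) d (λ ())
    ... | U ∷ ys , R , refl , p , r =
      step (U ∷ ys) R p r (go N R (ℕ.≤-trans (ℕ.m≤n+m (length R) (length ys))
                                            (subst (_≤ N) (List.length-++ ys) le)) r)

  primsAux-U : ∀ h acc xs → primsAux h acc (U ∷ xs) ≡ primsAux (suc h) (U ∷ acc) xs
  primsAux-U h []      xs = refl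
  primsAux-U h (_ ∷ _) xs = refl

  primsAux-D : ∀ h acc xs → primsAux (suc (suc h)) acc (D ∷ xs) ≡ primsAux (suc h) (D ∷ acc) xs
  primsAux-D h []      xs = refl
  primsAux-D h (_ ∷ _) xs = refl

  primsAux-D-ground : ∀ acc xs → primsAux 1 acc (D ∷ xs) ≡ reverse (D ∷ acc) ∷ primsAux 0 [] xs
  primsAux-D-ground []      xs = refl
  primsAux-D-ground (_ ∷ _) xs = refl

  primsAux-returnsAtEnd : ∀ h acc xs R → returnsAtEnd (suc h) xs ≡ true →
                          primsAux (suc h) acc (xs ++ R) ≡ (reverse acc ++ xs) ∷ prims R
  primsAux-returnsAtEnd h acc (U ∷ xs) R e = begin
    primsAux (suc h) acc (U ∷ xs ++ R)               ≡⟨ primsAux-U (suc h) acc (xs ++ R) ⟩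
    primsAux (suc (suc h)) (U ∷ acc) (xs ++ R)       ≡⟨ primsAux-returnsAtEnd (suc h) (U ∷ acc) xs R e ⟩
    (reverse (U ∷ acc) ++ xs) ∷ prims R              ≡⟨ cong (λ a → (a ++ xs) ∷ prims R) (List.unfold-reverse U acc) ⟩
    ((reverse acc ++ U ∷ []) ++ xs) ∷ prims R        ≡⟨ cong (_∷ prims R) (List.++-assoc (reverse acc) (U ∷ []) xs) ⟩
    (reverse acc ++ U ∷ xs) ∷ prims R                ∎
    where open ≡.≡-Reasoning
  primsAux-returnsAtEnd zero acc (D ∷ []) R e =
    trans (primsAux-D-ground acc R) (cong (_∷ prims R) (List.unfold-reverse D acc))
  primsAux-returnsAtEnd (suc h) acc (D ∷ xs) R e = begin
    primsAux (suc (suc h)) acc (D ∷ xs ++ R)         ≡⟨ primsAux-D h acc (xs ++ R) ⟩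
    primsAux (suc h) (D ∷ acc) (xs ++ R)             ≡⟨ primsAux-returnsAtEnd h (D ∷ acc) xs R e ⟩
    (reverse (D ∷ acc) ++ xs) ∷ prims R              ≡⟨ cong (λ a → (a ++ xs) ∷ prims R) (List.unfold-reverse D acc) ⟩
    ((reverse acc ++ D ∷ []) ++ xs) ∷ prims R        ≡⟨ cong (_∷ prims R) (List.++-assoc (reverse acc) (D ∷ []) xs) ⟩
    (reverse acc ++ D ∷ xs) ∷ prims R                ∎
    where open ≡.≡-Reasoning

  prims-primitive-++ : ∀ P R → isPrimitive P ≡ true → prims (P ++ R) ≡ P ∷ prims R
  prims-primitive-++ (U ∷ xs) R = primsAux-returnsAtEnd 0 (U ∷ []) xs R

  prims-primitive : ∀ P → isPrimitive P ≡ true → prims P ≡ P ∷ []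
  prims-primitive P p = trans (cong prims (sym (List.++-identityʳ P))) (prims-primitive-++ P [] p)

  valleyLevels-suc : ∀ h xs → dyckFrom h xs ≡ true → valleyLevels (suc h) xs ≡ map suc (valleyLevels h xs)
  valleyLevels-suc h       []           e = refl
  valleyLevels-suc zero    (U ∷ xs)     e = valleyLevels-suc 1 xs e
  valleyLevels-suc (suc h) (U ∷ xs)     e = valleyLevels-suc (suc (suc h)) xs e
  valleyLevels-suc (suc h) (D ∷ [])     e = refl
  valleyLevels-suc (suc h) (D ∷ U ∷ xs) e = cong (suc h ∷_) (valleyLevels-suc h (U ∷ xs) e)
  valleyLevels-suc (suc h) (D ∷ D ∷ xs) e = valleyLevels-suc h (D ∷ xs) e

  valleyLevels-∷ʳD : ∀ h xs → valleyLevels h (xs ++ D ∷ []) ≡ valleyLevels h xs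
  valleyLevels-∷ʳD h []           = refl
  valleyLevels-∷ʳD h (U ∷ xs)     = valleyLevels-∷ʳD (suc h) xs
  valleyLevels-∷ʳD h (D ∷ [])     = refl
  valleyLevels-∷ʳD h (D ∷ U ∷ xs) = cong ((h ∸ 1) ∷_) (valleyLevels-∷ʳD (h ∸ 1) (U ∷ xs))
  valleyLevels-∷ʳD h (D ∷ D ∷ xs) = valleyLevels-∷ʳD (h ∸ 1) (D ∷ xs)

  valleyLevels-elevate : ∀ Q → isDyck Q ≡ true → valleyLevels 0 (elevate Q) ≡ map suc (valleyLevels 0 Q)
  valleyLevels-elevate Q d = trans (valleyLevels-∷ʳD 1 Q) (valleyLevels-suc 0 Q d)

  valleyLevels-++-U : ∀ h ys R → returnsAtEnd (suc h) ys ≡ true →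
    valleyLevels (suc h) (ys ++ U ∷ R) ≡ valleyLevels (suc h) ys ++ 0 ∷ valleyLevels 0 (U ∷ R)
  valleyLevels-++-U h       (U ∷ ys)     R e = valleyLevels-++-U (suc h) ys R e
  valleyLevels-++-U zero    (D ∷ [])     R e = refl
  valleyLevels-++-U (suc h) (D ∷ U ∷ ys) R e = cong (suc h ∷_) (valleyLevels-++-U h (U ∷ ys) R e)
  valleyLevels-++-U (suc h) (D ∷ D ∷ ys) R e = valleyLevels-++-U h (D ∷ ys) R e

  nonPrimitive⇒groundValley : ∀ Q → isDyck Q ≡ true → isPrimitive Q ≡ false → Q ≢ [] →
    Σ (List ℕ) λ vs → Σ (List ℕ) λ ws → valleyLevels 0 Q ≡ vs ++ 0 ∷ ws
  nonPrimitive⇒groundValley Q d np Q≢[] with firstReturn Q d Q≢[]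
  ... | P , [] , refl , p , _ with trans (sym p) (trans (cong isPrimitive (sym (List.++-identityʳ P))) np)
  ...   | ()
  nonPrimitive⇒groundValley Q d np Q≢[] | U ∷ ys , U ∷ R , refl , p , _ =
    valleyLevels 1 ys , valleyLevels 0 (U ∷ R) , valleyLevels-++-U 0 ys R p

  valleyFree⇒primitive : ∀ Q → isDyck Q ≡ true → valleyLevels 0 Q ≡ [] → Q ≢ [] → isPrimitive Q ≡ true
  valleyFree⇒primitive Q d noValley Q≢[] with isPrimitive Q in p
  ... | true  = refl
  ... | false with nonPrimitive⇒groundValley Q d p Q≢[]
  ...   | ks , ks′ , eq with List.++-conicalʳ ks (0 ∷ ks′) (trans (sym eq) noValley)
  ...     | ()

  countU-∷ʳD : ∀ xs → countU (xs ++ D ∷ []) ≡ countU xs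
  countU-∷ʳD []       = refl
  countU-∷ʳD (U ∷ xs) = cong suc (countU-∷ʳD xs)
  countU-∷ʳD (D ∷ xs) = countU-∷ʳD xs

  countU-elevate : ∀ Q → countU (elevate Q) ≡ suc (countU Q)
  countU-elevate Q = cong suc (countU-∷ʳD Q)

  private
    U-step : ∀ h c → suc (suc h +ᴺ (c +ᴺ c)) ≡ h +ᴺ (suc c +ᴺ suc c)
    U-step = solve-∀

  dyckFrom-length : ∀ h xs → dyckFrom h xs ≡ true → length xs ≡ h +ᴺ (countU xs +ᴺ countU xs)
  dyckFrom-length zero    []       e = refl
  dyckFrom-length zero    (U ∷ xs) e = trans (cong suc (dyckFrom-length 1 xs e)) (U-step 0 (countU xs))
  dyckFrom-length (suc h) (U ∷ xs) e = trans (cong suc (dyckFrom-length (suc (suc h)) xs e)) (U-step (suc h) (countU xs))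
  dyckFrom-length (suc h) (D ∷ xs) e = cong suc (dyckFrom-length h xs e)

  allEq-map-suc : ∀ k vs → allEq (suc k) (map suc vs) ≡ allEq k vs
  allEq-map-suc k []       = refl
  allEq-map-suc k (v ∷ vs) = cong ((v ≡ᵇ k) ∧_) (allEq-map-suc k vs)

  allEq-suc-ground : ∀ k vs ws → allEq (suc k) (vs ++ 0 ∷ ws) ≡ false
  allEq-suc-ground k []       ws = refl
  allEq-suc-ground k (v ∷ vs) ws with v ≡ᵇ suc k
  ... | true  = allEq-suc-ground k vs ws
  ... | false = refl

  allEq-++ : ∀ k vs ws → allEq k (vs ++ ws) ≡ allEq k vs ∧ allEq k ws
  allEq-++ k []       ws = refl
  allEq-++ k (v ∷ vs) ws with v ≡ᵇ k
  ... | true  = allEq-++ k vs ws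
  ... | false = refl

  -- the middle part of u^k P' d^k, as cut out by primWeight
  middle : ℕ → Word → Word
  middle k P = drop k (take (length P ∸ k) P)

  middle-zero : ∀ Q → middle 0 Q ≡ Q
  middle-zero Q = List.take-all (length Q) Q ℕ.≤-refl

  middle-elevate : ∀ k Q → middle (suc k) (elevate Q) ≡ middle k Q
  middle-elevate k Q with k ≤? length Q
  ... | yes k≤ = begin
    drop (suc k) (take (length (Q ++ D ∷ []) ∸ k) (elevate Q))  ≡⟨ cong (λ j → drop (suc k) (take j (elevate Q))) cut ⟩
    drop k (take (length Q ∸ k) (Q ++ D ∷ []))                  ≡⟨ cong (drop k) (take-++ˡ (length Q ∸ k) Q (ℕ.m∸n≤m (length Q) k)) ⟩
    drop k (take (length Q ∸ k) Q)                              ∎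
    where
    open ≡.≡-Reasoning
    cut : length (Q ++ D ∷ []) ∸ k ≡ suc (length Q ∸ k)
    cut = trans (cong (_∸ k) (length-∷ʳ Q)) (ℕ.+-∸-assoc 1 k≤)
  ... | no k≰ = begin
    drop (suc k) (take (length (Q ++ D ∷ []) ∸ k) (elevate Q))  ≡⟨ cong (λ j → drop (suc k) (take j (elevate Q))) cut ⟩
    []                                                          ≡⟨ sym (List.drop-[] k) ⟩
    drop k []                                                   ≡⟨ cong (λ j → drop k (take j Q)) (sym (ℕ.m≤n⇒m∸n≡0 (ℕ.<⇒≤ k>))) ⟩
    drop k (take (length Q ∸ k) Q)                              ∎
    where
    open ≡.≡-Reasoning
    k> : length Q < k
    k> = ℕ.≰⇒> k≰
    cut : length (Q ++ D ∷ []) ∸ k ≡ 0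
    cut = trans (cong (_∸ k) (length-∷ʳ Q)) (ℕ.m≤n⇒m∸n≡0 k>)

open DyckWords

module Series {c ℓ : Level} (R : CommutativeRing c ℓ) where
  open CommutativeRing R hiding (zero)
  open Weights R
  open import Relation.Binary.Reasoning.Setoid setoid
  open import Algebra.Properties.Ring ring using ([y-z]x≈yx-zx)
  open import Algebra.Properties.CommutativeSemigroup +-commutativeSemigroup using (interchange; x∙yz≈y∙xz)
  open import Algebra.Properties.AbelianGroup +-abelianGroup using (⁻¹-∙-comm)

  Seq : Set c
  Seq = ℕ → Carrier

  infix 4 _≋_
  _≋_ : Seq → Seq → Set ℓ
  f ≋ g = ∀ n → f n ≈ g n

  infixl 7 _⊛_
  infixl 6 _⊞_ _⊟_

  _⊛_ : Seq → Seq → Seq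
  f ⊛ g = conv f g

  _⊞_ : Seq → Seq → Seq
  (f ⊞ g) n = f n + g n

  _⊟_ : Seq → Seq → Seq
  (f ⊟ g) n = f n - g n

  shift : Seq → Seq
  shift f n = f (suc n)

  ≋-setoid : Setoid c ℓ
  ≋-setoid = record
    { Carrier = Seq
    ; _≈_ = _≋_
    ; isEquivalence = record
      { refl  = λ _ → refl
      ; sym   = λ e n → sym (e n)
      ; trans = λ e e′ n → trans (e n) (e′ n)
      }
    }

  ⊞-cong : ∀ {f f′ g g′} → f ≋ f′ → g ≋ g′ → f ⊞ g ≋ f′ ⊞ g′
  ⊞-cong ef eg n = +-cong (ef n) (eg n)

  ⊟-cong : ∀ {f f′ g g′} → f ≋ f′ → g ≋ g′ → f ⊟ g ≋ f′ ⊟ g′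
  ⊟-cong ef eg n = +-cong (ef n) (-‿cong (eg n))

  convAux-cong : ∀ {f f′ g g′} → f ≋ f′ → g ≋ g′ → ∀ n i → convAux f g n i ≈ convAux f′ g′ n i
  convAux-cong ef eg n zero    = *-cong (ef 0) (eg n)
  convAux-cong ef eg n (suc i) = +-cong (*-cong (ef (suc i)) (eg _)) (convAux-cong ef eg n i)

  ⊛-cong : ∀ {f f′ g g′} → f ≋ f′ → g ≋ g′ → f ⊛ g ≋ f′ ⊛ g′
  ⊛-cong ef eg n = convAux-cong ef eg n n

  ⊛-congˡ : ∀ {f f′} g → f ≋ f′ → f ⊛ g ≋ f′ ⊛ g
  ⊛-congˡ g ef = ⊛-cong ef (λ _ → refl)

  ⊛-congʳ : ∀ f {g g′} → g ≋ g′ → f ⊛ g ≋ f ⊛ g′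
  ⊛-congʳ f eg = ⊛-cong (λ _ → refl) eg

  private
    interchange-− : ∀ a b c d → (a - b) + (c - d) ≈ (a + c) - (b + d)
    interchange-− a b c d = trans (interchange a (- b) c (- d)) (+-congˡ (⁻¹-∙-comm b d))

  convAux-suc : ∀ f g n i → convAux f g (suc n) (suc i) ≈ f 0 * g (suc n) + convAux (shift f) g n i
  convAux-suc f g n zero    = +-comm _ _
  convAux-suc f g n (suc i) = trans (+-congˡ (convAux-suc f g n i)) (x∙yz≈y∙xz _ _ _)

  ⊛-suc : ∀ f g n → (f ⊛ g) (suc n) ≈ f 0 * g (suc n) + (shift f ⊛ g) n
  ⊛-suc f g n = convAux-suc f g n n

  convAux-shiftʳ : ∀ f g n i → i ≤ n → convAux f g (suc n) i ≈ convAux f (shift g) n i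
  convAux-shiftʳ f g n zero    _  = refl
  convAux-shiftʳ f g n (suc i) le =
    +-cong (reflexive (≡.cong (λ k → f (suc i) * g k) (ℕ.+-∸-assoc 1 le)))
           (convAux-shiftʳ f g n i (ℕ.≤-trans (ℕ.n≤1+n i) le))

  ⊛-sucʳ : ∀ f g n → (f ⊛ g) (suc n) ≈ (f ⊛ shift g) n + f (suc n) * g 0
  ⊛-sucʳ f g n = trans
    (+-cong (reflexive (≡.cong (λ k → f (suc n) * g k) (ℕ.n∸n≡0 n))) (convAux-shiftʳ f g n n ℕ.≤-refl))
    (+-comm _ _)

  ⊛-comm : ∀ f g → f ⊛ g ≋ g ⊛ f
  ⊛-comm f g zero    = *-comm _ _
  ⊛-comm f g (suc n) = begin
    (f ⊛ g) (suc n)                ≈⟨ ⊛-suc f g n ⟩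
    f 0 * g (suc n) + (shift f ⊛ g) n  ≈⟨ +-cong (*-comm _ _) (⊛-comm (shift f) g n) ⟩
    g (suc n) * f 0 + (g ⊛ shift f) n  ≈⟨ +-comm _ _ ⟩
    (g ⊛ shift f) n + g (suc n) * f 0  ≈⟨ sym (⊛-sucʳ g f n) ⟩
    (g ⊛ f) (suc n)                ∎

  ⊛-distribʳ-⊞ : ∀ f f′ g → (f ⊞ f′) ⊛ g ≋ f ⊛ g ⊞ f′ ⊛ g
  ⊛-distribʳ-⊞ f f′ g n = go n
    where
    go : ∀ i → convAux (f ⊞ f′) g n i ≈ convAux f g n i + convAux f′ g n i
    go zero    = distribʳ _ _ _
    go (suc i) = trans (+-cong (distribʳ _ _ _) (go i)) (interchange _ _ _ _)

  ⊛-distribʳ-⊟ : ∀ f f′ g → (f ⊟ f′) ⊛ g ≋ f ⊛ g ⊟ f′ ⊛ g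
  ⊛-distribʳ-⊟ f f′ g n = go n
    where
    go : ∀ i → convAux (f ⊟ f′) g n i ≈ convAux f g n i - convAux f′ g n i
    go zero    = [y-z]x≈yx-zx _ _ _
    go (suc i) = trans (+-cong ([y-z]x≈yx-zx _ _ _) (go i)) (interchange-− _ _ _ _)

  ⊛-distribˡ-⊞ : ∀ f g g′ → f ⊛ (g ⊞ g′) ≋ f ⊛ g ⊞ f ⊛ g′
  ⊛-distribˡ-⊞ f g g′ n =
    trans (⊛-comm f _ n) (trans (⊛-distribʳ-⊞ g g′ f n) (+-cong (⊛-comm g f n) (⊛-comm g′ f n)))

  ⊛-distribˡ-⊟ : ∀ f g g′ → f ⊛ (g ⊟ g′) ≋ f ⊛ g ⊟ f ⊛ g′
  ⊛-distribˡ-⊟ f g g′ n =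
    trans (⊛-comm f _ n) (trans (⊛-distribʳ-⊟ g g′ f n) (⊟-cong (⊛-comm g f) (⊛-comm g′ f) n))

  ⊛-scaleˡ : ∀ a f g → (λ k → a * f k) ⊛ g ≋ (λ k → a * (f ⊛ g) k)
  ⊛-scaleˡ a f g n = go n
    where
    go : ∀ i → convAux (λ k → a * f k) g n i ≈ a * convAux f g n i
    go zero    = *-assoc _ _ _
    go (suc i) = trans (+-cong (*-assoc _ _ _) (go i)) (sym (distribˡ _ _ _))

  ⊛-identityˡ : ∀ f → oneS ⊛ f ≋ f
  ⊛-identityˡ f zero    = *-identityˡ _
  ⊛-identityˡ f (suc n) = trans (⊛-suc oneS f n) (trans (+-cong (*-identityˡ _) (vanish n)) (+-identityʳ _))
    where
    vanish : ∀ i → convAux (shift oneS) f n i ≈ 0#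
    vanish zero    = zeroˡ _
    vanish (suc i) = trans (+-cong (zeroˡ _) (vanish i)) (+-identityˡ _)

  ⊛-identityʳ : ∀ f → f ⊛ oneS ≋ f
  ⊛-identityʳ f n = trans (⊛-comm f oneS n) (⊛-identityˡ f n)

  ⊛-assoc : ∀ f g h → (f ⊛ g) ⊛ h ≋ f ⊛ (g ⊛ h)
  ⊛-assoc f g h zero    = *-assoc _ _ _
  ⊛-assoc f g h (suc n) = begin
    ((f ⊛ g) ⊛ h) (suc n)
      ≈⟨ ⊛-suc (f ⊛ g) h n ⟩
    (f 0 * g 0) * h (suc n) + (shift (f ⊛ g) ⊛ h) n
      ≈⟨ +-congˡ (⊛-congˡ h (⊛-suc f g) n) ⟩
    (f 0 * g 0) * h (suc n) + (((λ k → f 0 * shift g k) ⊞ shift f ⊛ g) ⊛ h) n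
      ≈⟨ +-congˡ (⊛-distribʳ-⊞ _ _ h n) ⟩
    (f 0 * g 0) * h (suc n) + (((λ k → f 0 * shift g k) ⊛ h) n + ((shift f ⊛ g) ⊛ h) n)
      ≈⟨ +-congˡ (+-cong (⊛-scaleˡ (f 0) (shift g) h n) (⊛-assoc (shift f) g h n)) ⟩
    (f 0 * g 0) * h (suc n) + (f 0 * (shift g ⊛ h) n + (shift f ⊛ (g ⊛ h)) n)
      ≈⟨ sym (+-assoc _ _ _) ⟩
    ((f 0 * g 0) * h (suc n) + f 0 * (shift g ⊛ h) n) + (shift f ⊛ (g ⊛ h)) n
      ≈⟨ +-congʳ (trans (+-congʳ (*-assoc _ _ _)) (sym (distribˡ _ _ _))) ⟩
    f 0 * (g 0 * h (suc n) + (shift g ⊛ h) n) + (shift f ⊛ (g ⊛ h)) n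
      ≈⟨ +-congʳ (*-congˡ (sym (⊛-suc g h n))) ⟩
    f 0 * (g ⊛ h) (suc n) + (shift f ⊛ (g ⊛ h)) n
      ≈⟨ sym (⊛-suc f (g ⊛ h) n) ⟩
    (f ⊛ (g ⊛ h)) (suc n) ∎

  sumUpTo : ℕ → (ℕ → Carrier) → Carrier
  sumUpTo zero    f = f 0
  sumUpTo (suc n) f = f (suc n) + sumUpTo n f

  sumUpTo-cong : ∀ n {f g} → (∀ m → m ≤ n → f m ≈ g m) → sumUpTo n f ≈ sumUpTo n g
  sumUpTo-cong zero    e = e 0 z≤n
  sumUpTo-cong (suc n) e = +-cong (e (suc n) ℕ.≤-refl) (sumUpTo-cong n (λ m le → e m (ℕ.m≤n⇒m≤1+n le)))

  sumUpTo-0# : ∀ n f → (∀ m → m ≤ n → f m ≈ 0#) → sumUpTo n f ≈ 0#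
  sumUpTo-0# zero    f e = e 0 z≤n
  sumUpTo-0# (suc n) f e =
    trans (+-cong (e _ ℕ.≤-refl) (sumUpTo-0# n f (λ m le → e m (ℕ.m≤n⇒m≤1+n le)))) (+-identityˡ 0#)

  sumUpTo-single : ∀ n k f → k ≤ n → (∀ m → m ≤ n → m ≢ k → f m ≈ 0#) → sumUpTo n f ≈ f k
  sumUpTo-single zero    .zero f z≤n e = refl
  sumUpTo-single (suc n) k     f le e with k ℕ.≟ suc n
  ... | yes ≡.refl =
    trans (+-congˡ (sumUpTo-0# n f (λ m m≤n → e m (ℕ.m≤n⇒m≤1+n m≤n) (λ { ≡.refl → ℕ.1+n≰n m≤n })))) (+-identityʳ _)
  ... | no k≢ =
    trans (+-cong (e (suc n) ℕ.≤-refl (λ eq → k≢ (≡.sym eq)))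
                  (sumUpTo-single n k f (ℕ.≤-pred (ℕ.≤∧≢⇒< le k≢)) (λ m le′ → e m (ℕ.m≤n⇒m≤1+n le′))))
          (+-identityˡ _)

  ⊛-sumUpTo : ∀ f g n → (f ⊛ g) n ≈ sumUpTo n (λ j → f j * g (n ∸ j))
  ⊛-sumUpTo f g n = go n
    where
    go : ∀ i → convAux f g n i ≈ sumUpTo i (λ j → f j * g (n ∸ j))
    go zero    = refl
    go (suc i) = +-congˡ (go i)

module SeriesEquations {c ℓ : Level} (R : CommutativeRing c ℓ) where
  open CommutativeRing R hiding (zero)
  open Weights R
  open Series R
  open import Relation.Binary.Reasoning.Setoid ≋-setoid
  open import Data.Maybe using (nothing)
  import Tactic.RingSolver.Core.AlmostCommutativeRing as ACR
  open import Tactic.RingSolver.NonReflective (ACR.fromCommutativeRing R (λ _ → nothing))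
    using (solve; _⊜_; _⊕_; ⊝_)

  open Setoid ≋-setoid using () renaming (refl to ≋-refl; sym to ≋-sym; trans to ≋-trans)

  private
    x+y-y≈x : ∀ x y → x + y - y ≈ x
    x+y-y≈x x y = trans (+-assoc x y (- y)) (trans (+-congˡ (-‿inverseʳ y)) (+-identityʳ x))

    x-y+y≈x : ∀ x y → x - y + y ≈ x
    x-y+y≈x x y = trans (+-assoc x (- y) y) (trans (+-congˡ (-‿inverseˡ y)) (+-identityʳ x))

    x≈y+z⇒x-z≈y : ∀ {x y z} → x ≈ y + z → x - z ≈ y
    x≈y+z⇒x-z≈y {z = z} e = trans (+-congʳ e) (x+y-y≈x _ z)

    cancel : ∀ {f g h} → f ≋ g ⊞ h → f ⊟ h ≋ g
    cancel e n = x≈y+z⇒x-z≈y (e n)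

    -- the solver cannot cancel x − x in an arbitrary ring, so the negatives enter as atoms
    telescope : ∀ o x y → o - ((o - x) + (x - y)) ≈ y
    telescope o x y = x≈y+z⇒x-z≈y (sym (trans
      (solve 5 (λ o x x′ y y′ → (y ⊕ ((o ⊕ x′) ⊕ (x ⊕ y′))) ⊜ (o ⊕ ((x ⊕ x′) ⊕ (y ⊕ y′)))) refl o x (- x) y (- y))
      (trans (+-congˡ (trans (+-cong (-‿inverseʳ x) (-‿inverseʳ y)) (+-identityʳ 0#))) (+-identityʳ o))))

  fixpoint⇒inverse : ∀ a x → x ≋ oneS ⊞ a ⊛ x → (oneS ⊟ a) ⊛ x ≋ oneS
  fixpoint⇒inverse a x fix = begin
    (oneS ⊟ a) ⊛ x         ≈⟨ ⊛-distribʳ-⊟ oneS a x ⟩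
    oneS ⊛ x ⊟ a ⊛ x       ≈⟨ ⊟-cong (⊛-identityˡ x) ≋-refl ⟩
    x ⊟ a ⊛ x              ≈⟨ cancel fix ⟩
    oneS                   ∎

  -- M = 1/(1 − a), Y = M − 1 − a = a²/(1 − a), A = ab + bY = ab/(1 − a), V = 1/(1 − A)
  closedForm : ∀ a b A V Y M →
    M ≋ oneS ⊞ a ⊛ M → M ≋ Y ⊞ (oneS ⊞ a) → A ≋ a ⊛ b ⊞ b ⊛ Y → V ≋ oneS ⊞ A ⊛ V →
    V ⊛ (oneS ⊟ a ⊟ a ⊛ b) ≋ oneS ⊟ a
  closedForm a b A V Y M M-fix M-split A-split V-fix = begin
    V ⊛ (q ⊟ a ⊛ b)             ≈⟨ ⊛-congʳ V (⊟-cong (⊛-identityʳ q) qA) ⟨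
    V ⊛ (q ⊛ oneS ⊟ q ⊛ A)      ≈⟨ ⊛-congʳ V (⊛-distribˡ-⊟ q oneS A) ⟨
    V ⊛ (q ⊛ (oneS ⊟ A))        ≈⟨ ⊛-comm V _ ⟩
    q ⊛ (oneS ⊟ A) ⊛ V          ≈⟨ ⊛-assoc q _ V ⟩
    q ⊛ ((oneS ⊟ A) ⊛ V)        ≈⟨ ⊛-congʳ q (fixpoint⇒inverse A V V-fix) ⟩
    q ⊛ oneS                    ≈⟨ ⊛-identityʳ q ⟩
    q                           ∎
    where
    q : Seq
    q = oneS ⊟ a

    qa : q ⊛ a ≋ a ⊟ a ⊛ a
    qa = ≋-trans (⊛-distribʳ-⊟ oneS a a) (⊟-cong (⊛-identityˡ a) ≋-refl)

    qY : q ⊛ Y ≋ a ⊛ a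
    qY = begin
      q ⊛ Y                         ≈⟨ ⊛-congʳ q (≋-sym (cancel M-split)) ⟩
      q ⊛ (M ⊟ (oneS ⊞ a))          ≈⟨ ⊛-distribˡ-⊟ q M _ ⟩
      q ⊛ M ⊟ q ⊛ (oneS ⊞ a)        ≈⟨ ⊟-cong (fixpoint⇒inverse a M M-fix) (⊛-distribˡ-⊞ q oneS a) ⟩
      oneS ⊟ (q ⊛ oneS ⊞ q ⊛ a)     ≈⟨ ⊟-cong ≋-refl (⊞-cong (⊛-identityʳ q) qa) ⟩
      oneS ⊟ (q ⊞ (a ⊟ a ⊛ a))      ≈⟨ (λ n → telescope (oneS n) (a n) ((a ⊛ a) n)) ⟩
      a ⊛ a                         ∎

    qA : q ⊛ A ≋ a ⊛ b
    qA = begin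
      q ⊛ A                             ≈⟨ ⊛-congʳ q A-split ⟩
      q ⊛ (a ⊛ b ⊞ b ⊛ Y)               ≈⟨ ⊛-distribˡ-⊞ q _ _ ⟩
      q ⊛ (a ⊛ b) ⊞ q ⊛ (b ⊛ Y)         ≈⟨ ⊞-cong (⊛-assoc q a b) (≋-trans (⊛-assoc q Y b) (⊛-congʳ q (⊛-comm Y b))) ⟨
      q ⊛ a ⊛ b ⊞ q ⊛ Y ⊛ b             ≈⟨ ⊞-cong (⊛-congˡ b qa) (⊛-congˡ b qY) ⟩
      (a ⊟ a ⊛ a) ⊛ b ⊞ a ⊛ a ⊛ b       ≈⟨ ⊞-cong (⊛-distribʳ-⊟ a (a ⊛ a) b) ≋-refl ⟩
      (a ⊛ b ⊟ a ⊛ a ⊛ b) ⊞ a ⊛ a ⊛ b   ≈⟨ (λ n → x-y+y≈x ((a ⊛ b) n) ((a ⊛ a ⊛ b) n)) ⟩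
      a ⊛ b                             ∎

module WordSums {c ℓ : Level} (R : CommutativeRing c ℓ) where
  open CommutativeRing R hiding (zero)
  open Weights R
  open Series R
  open import Relation.Binary.Reasoning.Setoid setoid
  open import Algebra.Properties.CommutativeSemigroup +-commutativeSemigroup using (interchange)

  wordSum : ℕ → (Word → Carrier) → Carrier
  wordSum L f = sumR (map f (words L))

  sumR-map-+ : ∀ {f g : Word → Carrier} ws → sumR (map (λ w → f w + g w) ws) ≈ sumR (map f ws) + sumR (map g ws)
  sumR-map-+ []       = sym (+-identityˡ 0#)
  sumR-map-+ (w ∷ ws) = trans (+-congˡ (sumR-map-+ ws)) (interchange _ _ _ _)

  sumR-map-*ʳ : ∀ {f : Word → Carrier} a ws → sumR (map (λ w → f w * a) ws) ≈ sumR (map f ws) * a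
  sumR-map-*ʳ a []       = sym (zeroˡ a)
  sumR-map-*ʳ a (w ∷ ws) = trans (+-congˡ (sumR-map-*ʳ a ws)) (sym (distribʳ _ _ _))

  wordSum-suc : ∀ L f → wordSum (suc L) f ≈ wordSum L (λ w → f (U ∷ w)) + wordSum L (λ w → f (D ∷ w))
  wordSum-suc L f = go (words L)
    where
    go : ∀ ws → sumR (map f (concatMap (λ w → (U ∷ w) ∷ (D ∷ w) ∷ []) ws))
                ≈ sumR (map (λ w → f (U ∷ w)) ws) + sumR (map (λ w → f (D ∷ w)) ws)
    go []       = sym (+-identityˡ 0#)
    go (w ∷ ws) = trans (+-congˡ (+-congˡ (go ws))) (trans (sym (+-assoc _ _ _)) (interchange _ _ _ _))

  wordSum-zero : ∀ f → wordSum 0 f ≈ f []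
  wordSum-zero f = +-identityʳ (f [])

  wordSum-cong : ∀ L {f g} → (∀ w → length w ≡ L → f w ≈ g w) → wordSum L f ≈ wordSum L g
  wordSum-cong zero    e = +-congʳ (e [] ≡.refl)
  wordSum-cong (suc L) {f} {g} e = begin
    wordSum (suc L) f  ≈⟨ wordSum-suc L f ⟩
    _                  ≈⟨ +-cong (wordSum-cong L (λ w eq → e (U ∷ w) (≡.cong suc eq)))
                                 (wordSum-cong L (λ w eq → e (D ∷ w) (≡.cong suc eq))) ⟩
    _                  ≈⟨ wordSum-suc L g ⟨
    wordSum (suc L) g  ∎

  wordSum-+ : ∀ L f g → wordSum L (λ w → f w + g w) ≈ wordSum L f + wordSum L g
  wordSum-+ L f g = sumR-map-+ (words L)

  wordSum-*ʳ : ∀ L f a → wordSum L (λ w → f w * a) ≈ wordSum L f * a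
  wordSum-*ʳ L f a = sumR-map-*ʳ a (words L)

  wordSum-*ˡ : ∀ L f a → wordSum L (λ w → a * f w) ≈ a * wordSum L f
  wordSum-*ˡ L f a = trans (wordSum-cong L (λ w _ → *-comm a (f w))) (trans (wordSum-*ʳ L f a) (*-comm _ a))

  wordSum-0# : ∀ L → wordSum L (λ _ → 0#) ≈ 0#
  wordSum-0# L = trans (wordSum-cong L (λ _ _ → sym (zeroˡ 0#))) (trans (wordSum-*ʳ L (λ _ → 0#) 0#) (zeroʳ _))

  wordSum-++ : ∀ a b f → wordSum (a +ᴺ b) f ≈ wordSum a (λ u → wordSum b (λ v → f (u ++ v)))
  wordSum-++ zero    b f = sym (wordSum-zero (λ u → wordSum b (λ v → f (u ++ v))))
  wordSum-++ (suc a) b f = begin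
    wordSum (suc (a +ᴺ b)) f  ≈⟨ wordSum-suc (a +ᴺ b) f ⟩
    _                         ≈⟨ +-cong (wordSum-++ a b (λ w → f (U ∷ w))) (wordSum-++ a b (λ w → f (D ∷ w))) ⟩
    _                         ≈⟨ wordSum-suc a _ ⟨
    _                         ∎

  sumR-filter : ∀ (p : Word → Bool) (h : Word → Carrier) ws →
    sumR (map h (filter (λ w → p w Data.Bool.≟ true) ws)) ≈ sumR (map (λ w → if p w then h w else 0#) ws)
  sumR-filter p h []       = refl
  sumR-filter p h (w ∷ ws) with p w
  ... | true  = +-congˡ (sumR-filter p h ws)
  ... | false = trans (sumR-filter p h ws) (sym (+-identityˡ _))

  wordSum-sumUpTo : ∀ L n (T : ℕ → Word → Carrier) →
                    wordSum L (λ w → sumUpTo n (λ m → T m w)) ≈ sumUpTo n (λ m → wordSum L (T m))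
  wordSum-sumUpTo L zero    T = refl
  wordSum-sumUpTo L (suc n) T = trans (wordSum-+ L _ _) (+-congˡ (wordSum-sumUpTo L n T))

module DyckSums {c ℓ : Level} (R : CommutativeRing c ℓ) where
  open CommutativeRing R hiding (zero)
  open Weights R
  open Series R
  open WordSums R
  open import Relation.Binary.Reasoning.Setoid setoid

  dyckTotal : ℕ → (Word → Carrier) → Carrier
  dyckTotal n F = wordSum (n +ᴺ n) (λ Q → if isDyck Q then F Q else 0#)

  primitiveTotal : ℕ → (Word → Carrier) → Carrier
  primitiveTotal n F = wordSum (n +ᴺ n) (λ P → if isPrimitive P then F P else 0#)

  if-cong : ∀ b {x y} → (b ≡ true → x ≈ y) → (if b then x else 0#) ≈ (if b then y else 0#)
  if-cong true  e = e ≡.refl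
  if-cong false e = refl

  if-+ : ∀ b x y → (if b then x + y else 0#) ≈ (if b then x else 0#) + (if b then y else 0#)
  if-+ true  x y = refl
  if-+ false x y = sym (+-identityʳ 0#)

  if-*ˡ : ∀ b a x → (if b then a * x else 0#) ≈ a * (if b then x else 0#)
  if-*ˡ true  a x = refl
  if-*ˡ false a x = sym (zeroʳ a)

  dyckTotal-cong : ∀ n {F G} → (∀ Q → isDyck Q ≡ true → F Q ≈ G Q) → dyckTotal n F ≈ dyckTotal n G
  dyckTotal-cong n e = wordSum-cong (n +ᴺ n) (λ Q _ → if-cong (isDyck Q) (e Q))

  dyckTotal-+ : ∀ n F G → dyckTotal n (λ Q → F Q + G Q) ≈ dyckTotal n F + dyckTotal n G
  dyckTotal-+ n F G = trans (wordSum-cong (n +ᴺ n) (λ Q _ → if-+ (isDyck Q) (F Q) (G Q))) (wordSum-+ (n +ᴺ n) _ _)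

  dyckTotal-*ˡ : ∀ n F a → dyckTotal n (λ Q → a * F Q) ≈ a * dyckTotal n F
  dyckTotal-*ˡ n F a = trans (wordSum-cong (n +ᴺ n) (λ Q _ → if-*ˡ (isDyck Q) a (F Q))) (wordSum-*ˡ (n +ᴺ n) _ a)

  dyckTotal-zero : ∀ F → dyckTotal 0 F ≈ F []
  dyckTotal-zero F = wordSum-zero (λ Q → if isDyck Q then F Q else 0#)

  primitiveTotal-zero : ∀ F → primitiveTotal 0 F ≈ 0#
  primitiveTotal-zero F = wordSum-zero (λ P → if isPrimitive P then F P else 0#)

  -- a primitive path of length 2n + 2 is u Q d with Q a Dyck path; other words fail on their first or last step
  primitiveTotal-suc : ∀ n F → primitiveTotal (suc n) F ≈ dyckTotal n (λ Q → F (elevate Q))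
  primitiveTotal-suc n F = begin
    wordSum (suc (n +ᴺ suc n)) f                            ≈⟨ wordSum-suc (n +ᴺ suc n) f ⟩
    wordSum (n +ᴺ suc n) (λ w → f (U ∷ w)) + wordSum (n +ᴺ suc n) (λ _ → 0#)
                                                            ≈⟨ trans (+-congˡ (wordSum-0# (n +ᴺ suc n))) (+-identityʳ _) ⟩
    wordSum (n +ᴺ suc n) (λ w → f (U ∷ w))                  ≡⟨ ≡.cong (λ L → wordSum L (λ w → f (U ∷ w))) (ℕ.+-suc n n) ⟩
    wordSum (suc (n +ᴺ n)) (λ w → f (U ∷ w))                ≡⟨ ≡.cong (λ L → wordSum L (λ w → f (U ∷ w))) (ℕ.+-comm 1 (n +ᴺ n)) ⟩
    wordSum ((n +ᴺ n) +ᴺ 1) (λ w → f (U ∷ w))               ≈⟨ wordSum-++ (n +ᴺ n) 1 (λ w → f (U ∷ w)) ⟩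
    wordSum (n +ᴺ n) (λ Q → wordSum 1 (λ e → f (U ∷ Q ++ e)))  ≈⟨ wordSum-cong (n +ᴺ n) (λ Q _ → last-step Q) ⟩
    dyckTotal n (λ Q → F (elevate Q))                       ∎
    where
    f : Word → Carrier
    f P = if isPrimitive P then F P else 0#
    last-step : ∀ Q → wordSum 1 (λ e → f (U ∷ Q ++ e)) ≈ (if isDyck Q then F (elevate Q) else 0#)
    last-step Q rewrite returnsAtEnd-∷ʳU 1 Q | returnsAtEnd-∷ʳD 0 Q = trans (+-identityˡ _) (+-identityʳ _)

  dyckTotal-suc : ∀ n F → (∀ Q → isDyck Q ≡ true → isPrimitive Q ≡ false → Q ≢ [] → F Q ≈ 0#) →
                  dyckTotal (suc n) F ≈ dyckTotal n (λ Q → F (elevate Q))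
  dyckTotal-suc n F vanish = trans (wordSum-cong (suc n +ᴺ suc n) only-primitive) (primitiveTotal-suc n F)
    where
    only-primitive : ∀ Q → length Q ≡ suc n +ᴺ suc n → (if isDyck Q then F Q else 0#) ≈ (if isPrimitive Q then F Q else 0#)
    only-primitive Q lQ with isPrimitive Q in p
    ... | true rewrite primitive⇒dyck Q p = refl
    ... | false with isDyck Q in d
    ...   | false = refl
    ...   | true  = vanish Q d p (length≡suc⇒≢[] lQ)

  module FirstReturn (ω : Word → Carrier) where

    dyckSeries : Seq
    dyckSeries n = dyckTotal n (λ Q → prodR (map ω (prims Q)))

    primitiveSeries : Seq
    primitiveSeries n = primitiveTotal n ω

    onPrimitive : Word → Carrier
    onPrimitive P = if isPrimitive P then ω P else 0#

    onDyck : Word → Carrier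
    onDyck Q = if isDyck Q then prodR (map ω (prims Q)) else 0#

    -- the contribution of w if its first return to the axis is at abscissa 2m + 2
    splitTerm : ℕ → Word → Carrier
    splitTerm m w = onPrimitive (take (suc m +ᴺ suc m) w) * onDyck (drop (suc m +ᴺ suc m) w)

    splitTerm-vanish : ∀ m w → (isPrimitive (take (suc m +ᴺ suc m) w) ≡ true → isDyck (drop (suc m +ᴺ suc m) w) ≡ true → ⊥) →
                       splitTerm m w ≈ 0#
    splitTerm-vanish m w split-fails with isPrimitive (take (suc m +ᴺ suc m) w) in p
    ... | false = zeroˡ _
    ... | true with isDyck (drop (suc m +ᴺ suc m) w) in d
    ...   | false = zeroʳ _
    ...   | true  = ⊥-elim (split-fails ≡.refl ≡.refl)

    splitTerms-firstReturn : ∀ n P Rest → isPrimitive P ≡ true → isDyck Rest ≡ true → length (P ++ Rest) ≡ suc n +ᴺ suc n →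
                             sumUpTo n (λ m → splitTerm m (P ++ Rest)) ≈ prodR (map ω (prims (P ++ Rest)))
    splitTerms-firstReturn n (U ∷ ys) Rest p r lw = begin
      sumUpTo n (λ m → splitTerm m w)        ≈⟨ sumUpTo-single n k (λ m → splitTerm m w) k≤n other-terms ⟩
      splitTerm k w                          ≡⟨ ≡.cong₂ (λ x y → onPrimitive x * onDyck y) take-P drop-P ⟩
      onPrimitive P * onDyck Rest            ≡⟨ ≡.cong₂ (λ x y → (if x then ω P else 0#) * (if y then prodR (map ω (prims Rest)) else 0#))
                                                         p r ⟩
      ω P * prodR (map ω (prims Rest))       ≡⟨ ≡.cong (λ Ps → prodR (map ω Ps)) (prims-primitive-++ P Rest p) ⟨
      prodR (map ω (prims w))                ∎
      where
      P = U ∷ ys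
      w = P ++ Rest
      k = countU ys
      length-P : length P ≡ suc k +ᴺ suc k
      length-P = dyckFrom-length 0 P (primitive⇒dyck P p)
      take-P : take (suc k +ᴺ suc k) w ≡ P
      take-P = ≡.subst (λ j → take j w ≡ P) length-P (take-length-++ P)
      drop-P : drop (suc k +ᴺ suc k) w ≡ Rest
      drop-P = ≡.subst (λ j → drop j w ≡ Rest) length-P (drop-length-++ P)
      k≤n : k ≤ n
      k≤n = ℕ.≤-pred (double-cancel-≤ (suc k) (suc n)
              (≡.subst₂ _≤_ length-P lw (≡.subst (length P ≤_) (≡.sym (List.length-++ P)) (ℕ.m≤m+n (length P) (length Rest)))))
      other-terms : ∀ m → m ≤ n → m ≢ k → splitTerm m w ≈ 0#
      other-terms m m≤n m≢k = splitTerm-vanish m w λ p′ _ → m≢k (ℕ.suc-injective (double-injective (suc m) (suc k)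
        (≡.trans (primitive-prefix-length (suc m +ᴺ suc m) P Rest
                    (≡.subst (suc m +ᴺ suc m ≤_) (≡.sym lw) (ℕ.+-mono-≤ (s≤s m≤n) (s≤s m≤n))) p′ p)
                 length-P)))

    onDyck-split : ∀ n w → length w ≡ suc n +ᴺ suc n → onDyck w ≈ sumUpTo n (λ m → splitTerm m w)
    onDyck-split n w lw with isDyck w in d
    ... | false = sym (sumUpTo-0# n _ λ m _ → splitTerm-vanish m w λ p r →
                    true≢false (≡.trans (≡.sym (primitive-++-dyck (suc m +ᴺ suc m) w p r)) d))
      where
      true≢false : true ≢ false
      true≢false ()
    ... | true with firstReturn w d (length≡suc⇒≢[] lw)
    ...   | P , Rest , ≡.refl , p , r = sym (splitTerms-firstReturn n P Rest p r lw)

    splitTerm-total : ∀ n m → m ≤ n → wordSum (suc n +ᴺ suc n) (splitTerm m) ≈ primitiveSeries (suc m) * dyckSeries (n ∸ m)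
    splitTerm-total n m m≤n = begin
      wordSum (suc n +ᴺ suc n) (splitTerm m)
        ≡⟨ ≡.cong (λ L → wordSum L (splitTerm m)) (double-split m n m≤n) ⟩
      wordSum (L₁ +ᴺ L₂) (splitTerm m)
        ≈⟨ wordSum-++ L₁ L₂ (splitTerm m) ⟩
      wordSum L₁ (λ u → wordSum L₂ (λ v → splitTerm m (u ++ v)))
        ≈⟨ wordSum-cong L₁ (λ u lu → trans (wordSum-cong L₂ (λ v _ → reflexive (split-at u v lu)))
                                           (wordSum-*ˡ L₂ onDyck (onPrimitive u))) ⟩
      wordSum L₁ (λ u → onPrimitive u * dyckSeries (n ∸ m))
        ≈⟨ wordSum-*ʳ L₁ onPrimitive (dyckSeries (n ∸ m)) ⟩
      primitiveSeries (suc m) * dyckSeries (n ∸ m) ∎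
      where
      L₁ = suc m +ᴺ suc m
      L₂ = (n ∸ m) +ᴺ (n ∸ m)
      split-at : ∀ u v → length u ≡ L₁ → splitTerm m (u ++ v) ≡ onPrimitive u * onDyck v
      split-at u v lu = ≡.cong₂ (λ x y → onPrimitive x * onDyck y)
        (≡.subst (λ j → take j (u ++ v) ≡ u) lu (take-length-++ u))
        (≡.subst (λ j → drop j (u ++ v) ≡ v) lu (drop-length-++ u))

    firstReturn-series : dyckSeries ≋ oneS ⊞ primitiveSeries ⊛ dyckSeries
    firstReturn-series zero = begin
      dyckSeries 0                               ≈⟨ dyckTotal-zero (λ Q → prodR (map ω (prims Q))) ⟩
      1#                                         ≈⟨ +-identityʳ 1# ⟨
      1# + 0#                                    ≈⟨ +-congˡ (trans (*-congʳ (primitiveTotal-zero ω)) (zeroˡ _)) ⟨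
      1# + primitiveSeries 0 * dyckSeries 0      ∎
    firstReturn-series (suc n) = begin
      dyckSeries (suc n)
        ≈⟨ wordSum-cong (suc n +ᴺ suc n) (onDyck-split n) ⟩
      wordSum (suc n +ᴺ suc n) (λ w → sumUpTo n (λ m → splitTerm m w))
        ≈⟨ wordSum-sumUpTo (suc n +ᴺ suc n) n splitTerm ⟩
      sumUpTo n (λ m → wordSum (suc n +ᴺ suc n) (splitTerm m))
        ≈⟨ sumUpTo-cong n (splitTerm-total n) ⟩
      sumUpTo n (λ m → shift primitiveSeries m * dyckSeries (n ∸ m))
        ≈⟨ ⊛-sumUpTo (shift primitiveSeries) dyckSeries n ⟨
      (shift primitiveSeries ⊛ dyckSeries) n
        ≈⟨ trans (+-congʳ (trans (*-congʳ (primitiveTotal-zero ω)) (zeroˡ _))) (+-identityˡ _) ⟨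
      primitiveSeries 0 * dyckSeries (suc n) + (shift primitiveSeries ⊛ dyckSeries) n
        ≈⟨ ⊛-suc primitiveSeries dyckSeries n ⟨
      (primitiveSeries ⊛ dyckSeries) (suc n)
        ≈⟨ +-identityˡ _ ⟨
      0# + (primitiveSeries ⊛ dyckSeries) (suc n) ∎

module Weighted {c ℓ : Level} (R : CommutativeRing c ℓ) (α β γ : ℕ → CommutativeRing.Carrier R) where
  open CommutativeRing R hiding (zero)
  open Weights R
  open Paths α β γ
  open Series R
  open WordSums R
  open DyckSums R
  open import Relation.Binary.Reasoning.Setoid setoid
  open import Data.Bool.Properties using (∧-identityʳ)

  pyramidProduct : List Word → Carrier
  pyramidProduct Ps = prodR (map (λ pyr → α (countU pyr)) Ps)

  pyramidWeight : Word → Carrier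
  pyramidWeight Q = pyramidProduct (prims Q)

  valleyFreeAt : (ℕ → Carrier) → Word → List ℕ → Carrier
  valleyFreeAt c P []      = c (countU P)
  valleyFreeAt c P (_ ∷ _) = 0#

  valleyFree : (ℕ → Carrier) → Word → Carrier
  valleyFree c P = valleyFreeAt c P (valleyLevels 0 P)

  levelledAt : (ℕ → Carrier) → Word → List ℕ → Carrier
  levelledAt b Q []       = 0#
  levelledAt b Q (k ∷ ks) = if allEq k ks then b k * pyramidWeight (middle k Q) else 0#

  -- b_k α_{i₁}⋯α_{iᵣ} if the valleys of Q = u^k u^{i₁}d^{i₁}⋯u^{iᵣ}d^{iᵣ} d^k all lie at level k, else 0
  levelled : (ℕ → Carrier) → Word → Carrier
  levelled b Q = levelledAt b Q (valleyLevels 0 Q)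

  private
    if-0#* : ∀ t x → (if t then 0# * x else 0#) ≈ 0#
    if-0#* true  x = zeroˡ x
    if-0#* false x = refl

  primWeight-split : ∀ P → primWeight P ≈ valleyFree γ P + levelled (ser β) P
  primWeight-split P with valleyLevels 0 P
  ... | []        = sym (+-identityʳ _)
  ... | zero ∷ ks = sym (trans (+-identityˡ _) (if-0#* (allEq 0 ks) _))
  ... | suc _ ∷ _ = sym (+-identityˡ _)

  valleyFree-elevate : ∀ c Q → isDyck Q ≡ true → valleyFree c (elevate Q) ≈ valleyFree (shift c) Q
  valleyFree-elevate c Q d rewrite valleyLevels-elevate Q d = lift (valleyLevels 0 Q)
    where
    lift : ∀ ks → valleyFreeAt c (elevate Q) (map suc ks) ≈ valleyFreeAt (shift c) Q ks
    lift []      = reflexive (≡.cong c (countU-elevate Q))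
    lift (_ ∷ _) = refl

  levelled-elevate : ∀ b Q → isDyck Q ≡ true → levelled (ser b) (elevate Q) ≈ levelled (shift b) Q
  levelled-elevate b Q d rewrite valleyLevels-elevate Q d = lift (valleyLevels 0 Q)
    where
    lift : ∀ ks → levelledAt (ser b) (elevate Q) (map suc ks) ≈ levelledAt (shift b) Q ks
    lift []       = refl
    lift (k ∷ ks) rewrite allEq-map-suc k ks | middle-elevate k Q = refl

  primWeight-elevate : ∀ Q → isDyck Q ≡ true → primWeight (elevate Q) ≈ valleyFree (shift γ) Q + levelled (shift β) Q
  primWeight-elevate Q d =
    trans (primWeight-split (elevate Q)) (+-cong (valleyFree-elevate γ Q d) (levelled-elevate β Q d))

  valleyFree-nonPrimitive : ∀ c Q → isDyck Q ≡ true → isPrimitive Q ≡ false → Q ≢ [] → valleyFree c Q ≈ 0#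
  valleyFree-nonPrimitive c Q d np Q≢[] with nonPrimitive⇒groundValley Q d np Q≢[]
  ... | []    , _ , eq rewrite eq = refl
  ... | _ ∷ _ , _ , eq rewrite eq = refl

  levelled-ser-nonPrimitive : ∀ b Q → isDyck Q ≡ true → isPrimitive Q ≡ false → Q ≢ [] → levelled (ser b) Q ≈ 0#
  levelled-ser-nonPrimitive b Q d np Q≢[] with nonPrimitive⇒groundValley Q d np Q≢[]
  ... | []           , ks′ , eq rewrite eq = if-0#* (allEq 0 ks′) _
  ... | zero ∷ ks    , ks′ , eq rewrite eq = if-0#* (allEq 0 (ks ++ 0 ∷ ks′)) _
  ... | suc k ∷ ks   , ks′ , eq rewrite eq | allEq-suc-ground k ks ks′ = refl

  dyckTotal-valleyFree : ∀ n c → dyckTotal n (valleyFree c) ≈ c n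
  dyckTotal-valleyFree zero    c = dyckTotal-zero (valleyFree c)
  dyckTotal-valleyFree (suc n) c = begin
    dyckTotal (suc n) (valleyFree c)                    ≈⟨ dyckTotal-suc n (valleyFree c) (valleyFree-nonPrimitive c) ⟩
    dyckTotal n (λ Q → valleyFree c (elevate Q))        ≈⟨ dyckTotal-cong n (valleyFree-elevate c) ⟩
    dyckTotal n (valleyFree (shift c))                  ≈⟨ dyckTotal-valleyFree n (shift c) ⟩
    c (suc n)                                           ∎

  levelled-split : ∀ b Q → levelled b Q ≈ b 0 * levelled oneS Q + levelled (ser b) Q
  levelled-split b Q = go (valleyLevels 0 Q)
    where
    go : ∀ ks → levelledAt b Q ks ≈ b 0 * levelledAt oneS Q ks + levelledAt (ser b) Q ks
    go [] = sym (trans (+-identityʳ _) (zeroʳ _))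
    go (zero ∷ ks) with allEq 0 ks
    ... | true  = sym (trans (+-cong (*-congˡ (*-identityˡ _)) (zeroˡ _)) (+-identityʳ _))
    ... | false = sym (trans (+-identityʳ _) (zeroʳ _))
    go (suc k ∷ ks) with allEq (suc k) ks
    ... | true  = sym (trans (+-congʳ (trans (*-congˡ (zeroˡ _)) (zeroʳ _))) (+-identityˡ _))
    ... | false = sym (trans (+-identityʳ _) (zeroʳ _))

  -- sequences of at least two pyramids standing on the axis
  manyPyramids : Seq
  manyPyramids n = dyckTotal n (levelled oneS)

  dyckTotal-levelled : ∀ n b → dyckTotal n (levelled b) ≈ (b ⊛ manyPyramids) n
  dyckTotal-levelled n b = trans
    (trans (dyckTotal-cong n (λ Q _ → levelled-split b Q))
           (trans (dyckTotal-+ n _ _) (+-congʳ (dyckTotal-*ˡ n (levelled oneS) (b 0)))))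
    (positive-levels n)
    where
    positive-levels : ∀ n → b 0 * manyPyramids n + dyckTotal n (levelled (ser b)) ≈ (b ⊛ manyPyramids) n
    positive-levels zero    = trans (+-congˡ (dyckTotal-zero (levelled (ser b)))) (+-identityʳ _)
    positive-levels (suc n) = begin
      b 0 * manyPyramids (suc n) + dyckTotal (suc n) (levelled (ser b))
        ≈⟨ +-congˡ (dyckTotal-suc n (levelled (ser b)) (levelled-ser-nonPrimitive b)) ⟩
      b 0 * manyPyramids (suc n) + dyckTotal n (λ Q → levelled (ser b) (elevate Q))
        ≈⟨ +-congˡ (dyckTotal-cong n (levelled-elevate b)) ⟩
      b 0 * manyPyramids (suc n) + dyckTotal n (levelled (shift b))
        ≈⟨ +-congˡ (dyckTotal-levelled n (shift b)) ⟩
      b 0 * manyPyramids (suc n) + (shift b ⊛ manyPyramids) n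
        ≈⟨ ⊛-suc b manyPyramids n ⟨
      (b ⊛ manyPyramids) (suc n) ∎

  primitiveWeights-split : FirstReturn.primitiveSeries primWeight ≋ ser γ ⊞ ser β ⊛ manyPyramids
  primitiveWeights-split zero =
    trans (primitiveTotal-zero primWeight) (sym (trans (+-identityˡ _) (zeroˡ _)))
  primitiveWeights-split (suc n) = begin
    primitiveTotal (suc n) primWeight
      ≈⟨ primitiveTotal-suc n primWeight ⟩
    dyckTotal n (λ Q → primWeight (elevate Q))
      ≈⟨ dyckTotal-cong n primWeight-elevate ⟩
    dyckTotal n (λ Q → valleyFree (shift γ) Q + levelled (shift β) Q)
      ≈⟨ dyckTotal-+ n _ _ ⟩
    dyckTotal n (valleyFree (shift γ)) + dyckTotal n (levelled (shift β))
      ≈⟨ +-cong (dyckTotal-valleyFree n (shift γ)) (dyckTotal-levelled n (shift β)) ⟩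
    γ (suc n) + (shift β ⊛ manyPyramids) n
      ≈⟨ +-congˡ (trans (+-congʳ (zeroˡ _)) (+-identityˡ _)) ⟨
    γ (suc n) + (0# * manyPyramids (suc n) + (shift β ⊛ manyPyramids) n)
      ≈⟨ +-congˡ (⊛-suc (ser β) manyPyramids n) ⟨
    γ (suc n) + (ser β ⊛ manyPyramids) (suc n) ∎

  pyramidSeqWeight : Word → Carrier
  pyramidSeqWeight Q = if allEq 0 (valleyLevels 0 Q) then pyramidWeight Q else 0#

  pyramidSequences : Seq
  pyramidSequences n = dyckTotal n pyramidSeqWeight

  pyramidSeqWeight-split : ∀ Q → isDyck Q ≡ true → pyramidSeqWeight Q ≈ levelled oneS Q + valleyFree (oneS ⊞ ser α) Q
  pyramidSeqWeight-split Q d with valleyLevels 0 Q in vs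
  ... | zero ∷ ks with allEq 0 ks
  ...   | true  = begin
          pyramidWeight Q                 ≡⟨ ≡.cong pyramidWeight (middle-zero Q) ⟨
          pyramidWeight (middle 0 Q)      ≈⟨ *-identityˡ _ ⟨
          1# * pyramidWeight (middle 0 Q) ≈⟨ +-identityʳ _ ⟨
          1# * pyramidWeight (middle 0 Q) + 0# ∎
  ...   | false = sym (+-identityʳ 0#)
  pyramidSeqWeight-split Q        d | suc k ∷ ks = sym (trans (+-identityʳ _) (if-0#* (allEq (suc k) ks) _))
  pyramidSeqWeight-split []       d | []         = sym (trans (+-identityˡ _) (+-identityʳ 1#))
  pyramidSeqWeight-split (U ∷ ys) d | []         =
    trans (reflexive (≡.cong pyramidProduct (prims-primitive (U ∷ ys) (valleyFree⇒primitive (U ∷ ys) d vs (λ ())))))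
          (trans (*-identityʳ _) (sym (trans (+-identityˡ _) (+-identityˡ _))))

  pyramidSequences-split : pyramidSequences ≋ manyPyramids ⊞ (oneS ⊞ ser α)
  pyramidSequences-split n =
    trans (dyckTotal-cong n pyramidSeqWeight-split)
          (trans (dyckTotal-+ n _ _) (+-congˡ (dyckTotal-valleyFree n (oneS ⊞ ser α))))

  pyramidSeqWeight-++ : ∀ P R → isPrimitive P ≡ true → isDyck R ≡ true →
                        pyramidSeqWeight (P ++ R) ≈ valleyFree α P * pyramidSeqWeight R
  pyramidSeqWeight-++ (U ∷ ys) R p r with returnsAtEnd⇒∷ʳD 0 ys p
  ... | Q , ≡.refl , d = glue R r
    where
    P = elevate Q
    v = valleyLevels 0 Q
    lifted : valleyLevels 0 P ≡ map suc v
    lifted = valleyLevels-elevate Q d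
    combine : ∀ ks t X → (if allEq 0 (map suc ks) ∧ t then α (countU P) * X else 0#) ≈
                         valleyFreeAt α P (map suc ks) * (if t then X else 0#)
    combine []      t X = if-*ˡ t _ X
    combine (_ ∷ _) t X = sym (zeroˡ _)
    glue : ∀ R → isDyck R ≡ true → pyramidSeqWeight (P ++ R) ≈ valleyFree α P * pyramidSeqWeight R
    glue [] _ = begin
      pyramidSeqWeight (P ++ [])                                     ≡⟨ ≡.cong pyramidSeqWeight (List.++-identityʳ P) ⟩
      pyramidSeqWeight P                                             ≡⟨ ≡.cong₂ (λ ks Ps → if allEq 0 ks then pyramidProduct Ps else 0#)
                                                                                lifted (prims-primitive P p) ⟩
      (if allEq 0 (map suc v) then α (countU P) * 1# else 0#)        ≡⟨ ≡.cong (λ t → if t then α (countU P) * 1# else 0#) (∧-identityʳ _) ⟨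
      (if allEq 0 (map suc v) ∧ true then α (countU P) * 1# else 0#) ≈⟨ combine v true 1# ⟩
      valleyFreeAt α P (map suc v) * 1#                              ≡⟨ ≡.cong (λ ks → valleyFreeAt α P ks * 1#) lifted ⟨
      valleyFree α P * pyramidSeqWeight []                           ∎
    glue (U ∷ R′) _ = begin
      pyramidSeqWeight (P ++ U ∷ R′)
        ≡⟨ ≡.cong₂ (λ ks Ps → if allEq 0 ks then pyramidProduct Ps else 0#)
                   (≡.trans (valleyLevels-++-U 0 ys R′ p) (≡.cong (_++ 0 ∷ w) lifted)) (prims-primitive-++ P (U ∷ R′) p) ⟩
      (if allEq 0 (map suc v ++ 0 ∷ w) then α (countU P) * pyramidWeight (U ∷ R′) else 0#)
        ≡⟨ ≡.cong (λ t → if t then α (countU P) * pyramidWeight (U ∷ R′) else 0#) (allEq-++ 0 (map suc v) (0 ∷ w)) ⟩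
      (if allEq 0 (map suc v) ∧ allEq 0 w then α (countU P) * pyramidWeight (U ∷ R′) else 0#)
        ≈⟨ combine v (allEq 0 w) (pyramidWeight (U ∷ R′)) ⟩
      valleyFreeAt α P (map suc v) * pyramidSeqWeight (U ∷ R′)
        ≡⟨ ≡.cong (λ ks → valleyFreeAt α P ks * pyramidSeqWeight (U ∷ R′)) lifted ⟨
      valleyFree α P * pyramidSeqWeight (U ∷ R′) ∎
      where w = valleyLevels 0 (U ∷ R′)

  pyramidSeqWeight-factor : ∀ Q → isDyck Q ≡ true → pyramidSeqWeight Q ≈ prodR (map (valleyFree α) (prims Q))
  pyramidSeqWeight-factor = dyck-induction (λ Q → pyramidSeqWeight Q ≈ prodR (map (valleyFree α) (prims Q))) refl
    λ P R p r ih → trans (pyramidSeqWeight-++ P R p r)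
                         (trans (*-congˡ ih)
                                (reflexive (≡.cong (λ Ps → prodR (map (valleyFree α) Ps)) (≡.sym (prims-primitive-++ P R p)))))

  private module PyramidFactors = FirstReturn (valleyFree α)

  pyramidSequences-fix : pyramidSequences ≋ oneS ⊞ ser α ⊛ pyramidSequences
  pyramidSequences-fix n = trans (as-dyckSeries n)
    (trans (PyramidFactors.firstReturn-series n) (+-congˡ (⊛-cong heights (λ m → sym (as-dyckSeries m)) n)))
    where
    as-dyckSeries : pyramidSequences ≋ PyramidFactors.dyckSeries
    as-dyckSeries n = dyckTotal-cong n pyramidSeqWeight-factor
    heights : PyramidFactors.primitiveSeries ≋ ser α
    heights zero    = primitiveTotal-zero (valleyFree α)
    heights (suc n) = trans (primitiveTotal-suc n (valleyFree α))
                            (trans (dyckTotal-cong n (valleyFree-elevate α)) (dyckTotal-valleyFree n (shift α)))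

  V≋dyckSeries : V ≋ FirstReturn.dyckSeries primWeight
  V≋dyckSeries n = sumR-filter isDyck pathWeight (words (n +ᴺ n))

corollary2p2 : {c ℓ : Level} (R : CommutativeRing c ℓ) (α β γ : ℕ → CommutativeRing.Carrier R) →
  let open CommutativeRing R
      open Weights R
      open Paths α β γ
  in (∀ n → ser γ n ≈ conv (ser α) (ser β) n) →
     ∀ n → conv V (λ k → oneS k - ser α k - conv (ser α) (ser β) k) n ≈ (oneS n - ser α n)
corollary2p2 R α β γ γ≈αβ =
  closedForm (ser α) (ser β) A V manyPyramids pyramidSequences pyramidSequences-fix pyramidSequences-split A-split V-fix
  where
  open CommutativeRing R
  open Weights R
  open Paths α β γ
  open Series R
  open SeriesEquations R
  open DyckSums R
  open Weighted R α β γ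
  open FirstReturn primWeight renaming (primitiveSeries to A)

  A-split : A ≋ ser α ⊛ ser β ⊞ ser β ⊛ manyPyramids
  A-split n = trans (primitiveWeights-split n) (+-congʳ (γ≈αβ n))

  V-fix : V ≋ oneS ⊞ A ⊛ V
  V-fix n = trans (V≋dyckSeries n) (trans (firstReturn-series n) (+-congˡ (⊛-congʳ A (λ m → sym (V≋dyckSeries m)) n)))
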